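{- Let $n, m$ be positive integers, let $(S_i)_{i \in \{1,\dots,m\}}$ be a family of pairwise distinct elements of $\Pi_{\le 2}(n)$, and let $T \in \Pi_{\le 2}(n)$. Assume that there are $r, s \in \{1,\dots,m\}$, $r \neq s$, such that $|S_r| = 2$, $S_r \neq T \neq S_s$, and the set $C := S_r \oplus S_s \oplus T$ satisfies $|C| \notin \{1,2\}$. Then at least one of the following holds: (i) there exist $p, q \in \{1,\dots,m\}$, $p \neq q$, with $|S_p \oplus S_q \oplus C| \in \{0,3,4,5,6\}$; (ii) there exists $b \in \{1,\dots,n\}$ with $b \in S_i$ for all $i \in \{1,\dots,m\}$; (iii) $m \leq 5$.
   Context: $\Pi_{\le 2}(n)$ denotes the set of all 1-element or 2-element subsets of $\{1,\dots,n\}$. $S \oplus T = (S\setminus T)\cup(T \setminus S)$ is the symmetric difference. -}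

module Defs where

open import Data.Nat using (ℕ)
open import Data.Sum using (_⊎_)
open import Data.Fin.Subset using (Subset; _∪_; _─_; ∣_∣)
open import Relation.Binary.PropositionalEquality using (_≡_)

infixl 6 _⊕_
_⊕_ : ∀ {n} → Subset n → Subset n → Subset n
S ⊕ T = (S ─ T) ∪ (T ─ S)

InΠ≤2 : ∀ {n} → Subset n → Set
InΠ≤2 S = ∣ S ∣ ≡ 1 ⊎ ∣ S ∣ ≡ 2

-- Write C = S r ⊕ S s ⊕ T, and suppose that m > 5 and that no pair p ≢ q is a witness for (i).
-- If C ≠ ∅ then ∣C∣ ≥ 3, and already S r, S s, T and three further sets S k contradict the
-- absence of witnesses.  If C = ∅, the absence of witnesses says ∣S p ⊕ S q∣ ∈ {1, 2} for all
-- p ≢ q; writing S r = {a, b}, a set missing a together with a set missing b (they may coincide,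
-- otherwise a fourth set is added) would again give a witness, so if a is not in every S i then
-- b is.
-- Each of these configurations involves at most twelve points, and only the pattern of
-- coincidences among them matters.  So each is refuted by enumerating those patterns as
-- restricted growth labellings of the points and evaluating the cardinality constraints on each
-- of them; the enumeration is shown sound once and for all, by following the labelling of an
-- actual point assignment by first occurrences.
module Submission where

open import Defs
open import Data.Nat using (ℕ; suc; _≤_; NonZero)
open import Data.Fin using (Fin)
open import Data.Fin.Subset using (Subset; _∈_; ∣_∣)
open import Data.Product using (∃; ∃-syntax; _×_)
open import Data.Sum using (_⊎_)
open import Relation.Binary.PropositionalEquality using (_≡_; _≢_)
open import Relation.Nullary using (¬_)

open import Data.Bool using (Bool; true; false; not; _∧_; _∨_; _xor_; if_then_else_; T)
open import Data.Bool.ListAction using (all; any)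
open import Data.Bool.Properties
  using (xor-assoc; xor-identityˡ; xor-identityʳ; T-≡; T-not-≡; T-∧; T-∨; ¬-not)
open import Data.Empty using (⊥-elim)
open import Data.Fin using (zero; suc; _≟_)
open import Data.Fin.Properties using (any?; all?; ¬∀⟶∃¬; pigeonhole) renaming (<⇒≢ to <⇒≢ᶠ)
open import Data.Fin.Subset using (⊥; ⁅_⁆; _∪_)
open import Data.Fin.Subset.Properties
  using (_∈?_; x∈p∪q⁺; x∈⁅x⁆; ∪-idem; ∪-identityˡ; ∪-identityʳ; ∣⊥∣≡0)
open import Data.List using (List; []; _∷_; _++_; foldr; map; upTo; head; drop; length)
import Data.List as List
open import Data.List.Membership.Propositional.Properties using (∈-upTo⁺)
open import Data.List.Properties using (map-cong-local; length-++)
open import Data.List.Relation.Unary.All as All using (All; []; _∷_)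
open import Data.List.Relation.Unary.All.Properties using (all⁺; ++⁺; map⁺; map⁻)
open import Data.List.Relation.Unary.All.Properties.Core using (¬Any⇒All¬; All¬⇒¬Any)
open import Data.List.Relation.Unary.AllPairs as AllPairs using (AllPairs; []; _∷_)
open import Data.List.Relation.Unary.AllPairs.Properties using () renaming (map⁺ to AllPairs-map⁺)
import Data.List.Relation.Unary.Any as Any
open import Data.List.Relation.Unary.Any.Properties using (any⁻; lookup-index)
open import Data.List.Relation.Unary.Unique.Propositional using (Unique)
open import Data.Maybe using (fromMaybe)
import Data.Nat as ℕ
open import Data.Nat using (zero; pred; _*_; _+_; _<_; _≤?_; _≡ᵇ_; _<ᵇ_; z≤n; s≤s; s≤s⁻¹)
open import Data.Nat.Properties
  using (≤-trans; ≤-refl; ≤-total; ≤∧≢⇒<; m≤n⇒m<n∨m≡n; m≤n⇒m≤1+n; n≤1+n; <⇒≤; ≰⇒>; ≮⇒≥; <⇒≱;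
         suc-injective; <ᵇ⇒<; ≡ᵇ⇒≡; ≡⇒≡ᵇ)
open import Data.Product using (∃₂; _,_; proj₁)
open import Data.Sum using (inj₁; inj₂)
open import Data.Unit using (tt)
open import Data.Vec using ([]; _∷_; zipWith; lookup)
open import Data.Vec.Properties
  using (zipWith-assoc; zipWith-identityˡ; zipWith-identityʳ; lookup-zipWith; lookup-replicate; lookup⇒[]=)
open import Function using (_∘_; id; Equivalence; mk⇔)
open import Relation.Binary.PropositionalEquality
  using (refl; sym; trans; cong; cong₂; subst; ≢-sym; module ≡-Reasoning)
open import Relation.Nullary using (Dec; yes; no; does)
open import Relation.Nullary.Decidable
  using (⌊_⌋; ¬?; _×-dec_; _⊎-dec_; fromWitness; toWitness; dec-false; does-⇔)
open import Relation.Nullary.Negation using (contradiction)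

⊕-∷ : ∀ {n} x y (p q : Subset n) → (x ∷ p) ⊕ (y ∷ q) ≡ (x xor y) ∷ (p ⊕ q)
⊕-∷ false false p q = refl
⊕-∷ false true  p q = refl
⊕-∷ true  false p q = refl
⊕-∷ true  true  p q = refl

⊕-zipWith : ∀ {n} (p q : Subset n) → p ⊕ q ≡ zipWith _xor_ p q
⊕-zipWith []      []      = refl
⊕-zipWith (x ∷ p) (y ∷ q) = trans (⊕-∷ x y p q) (cong ((x xor y) ∷_) (⊕-zipWith p q))

⊕-assoc : ∀ {n} (p q r : Subset n) → (p ⊕ q) ⊕ r ≡ p ⊕ (q ⊕ r)
⊕-assoc p q r
  rewrite ⊕-zipWith (p ⊕ q) r | ⊕-zipWith p q | ⊕-zipWith p (q ⊕ r) | ⊕-zipWith q r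
  = zipWith-assoc xor-assoc p q r

⊕-identityˡ : ∀ {n} (p : Subset n) → ⊥ ⊕ p ≡ p
⊕-identityˡ p rewrite ⊕-zipWith ⊥ p = zipWith-identityˡ xor-identityˡ p

⊕-identityʳ : ∀ {n} (p : Subset n) → p ⊕ ⊥ ≡ p
⊕-identityʳ p rewrite ⊕-zipWith p ⊥ = zipWith-identityʳ xor-identityʳ p

lookup-⊕ : ∀ {n} (p q : Subset n) x → lookup (p ⊕ q) x ≡ lookup p x xor lookup q x
lookup-⊕ p q x rewrite ⊕-zipWith p q = lookup-zipWith _xor_ x p q

lookup-⁅⁆ : ∀ {n} (y x : Fin n) → lookup ⁅ y ⁆ x ≡ does (x ≟ y)
lookup-⁅⁆ zero    zero    = refl
lookup-⁅⁆ zero    (suc x) = lookup-replicate x false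
lookup-⁅⁆ (suc y) zero    = refl
lookup-⁅⁆ (suc y) (suc x) = lookup-⁅⁆ y x

suc∣⁅x⁆⊕p∣≡∣p∣ : ∀ {n} (x : Fin n) p → lookup p x ≡ true → suc ∣ ⁅ x ⁆ ⊕ p ∣ ≡ ∣ p ∣
suc∣⁅x⁆⊕p∣≡∣p∣ zero    (true  ∷ p) refl = cong (suc ∘ ∣_∣) (⊕-identityˡ p)
suc∣⁅x⁆⊕p∣≡∣p∣ (suc x) (true  ∷ p) x∈p  = cong suc (suc∣⁅x⁆⊕p∣≡∣p∣ x p x∈p)
suc∣⁅x⁆⊕p∣≡∣p∣ (suc x) (false ∷ p) x∈p  = suc∣⁅x⁆⊕p∣≡∣p∣ x p x∈p

∣⁅x⁆⊕p∣≡suc∣p∣ : ∀ {n} (x : Fin n) p → lookup p x ≡ false → ∣ ⁅ x ⁆ ⊕ p ∣ ≡ suc ∣ p ∣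
∣⁅x⁆⊕p∣≡suc∣p∣ zero    (false ∷ p) refl = cong (suc ∘ ∣_∣) (⊕-identityˡ p)
∣⁅x⁆⊕p∣≡suc∣p∣ (suc x) (true  ∷ p) x∉p  = cong suc (∣⁅x⁆⊕p∣≡suc∣p∣ x p x∉p)
∣⁅x⁆⊕p∣≡suc∣p∣ (suc x) (false ∷ p) x∉p  = ∣⁅x⁆⊕p∣≡suc∣p∣ x p x∉p

∣⁅x⁆⊕p∣ : ∀ {n} (x : Fin n) p → ∣ ⁅ x ⁆ ⊕ p ∣ ≡ (if lookup p x then pred else suc) ∣ p ∣
∣⁅x⁆⊕p∣ x p with lookup p x in x∈?p
... | true  = cong pred (suc∣⁅x⁆⊕p∣≡∣p∣ x p x∈?p)
... | false = ∣⁅x⁆⊕p∣≡suc∣p∣ x p x∈?p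

⁅x⁆∪⁅y⁆≡⁅x⁆⊕⁅y⁆ : ∀ {n} {x y : Fin n} → x ≢ y → ⁅ x ⁆ ∪ ⁅ y ⁆ ≡ ⁅ x ⁆ ⊕ ⁅ y ⁆
⁅x⁆∪⁅y⁆≡⁅x⁆⊕⁅y⁆ {x = zero}  {zero}  x≢y = contradiction refl x≢y
⁅x⁆∪⁅y⁆≡⁅x⁆⊕⁅y⁆ {x = zero}  {suc y} _   = cong (true ∷_) (trans (∪-identityˡ ⁅ y ⁆) (sym (⊕-identityˡ ⁅ y ⁆)))
⁅x⁆∪⁅y⁆≡⁅x⁆⊕⁅y⁆ {x = suc x} {zero}  _   = cong (true ∷_) (trans (∪-identityʳ ⁅ x ⁆) (sym (⊕-identityʳ ⁅ x ⁆)))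
⁅x⁆∪⁅y⁆≡⁅x⁆⊕⁅y⁆ {x = suc x} {suc y} x≢y = cong (false ∷_) (⁅x⁆∪⁅y⁆≡⁅x⁆⊕⁅y⁆ (x≢y ∘ cong suc))

∣p∣≡0⇒p≡⊥ : ∀ {n} (p : Subset n) → ∣ p ∣ ≡ 0 → p ≡ ⊥
∣p∣≡0⇒p≡⊥ []          _     = refl
∣p∣≡0⇒p≡⊥ (false ∷ p) ∣p∣≡0 = cong (false ∷_) (∣p∣≡0⇒p≡⊥ p ∣p∣≡0)

∣p∣≡1⇒p≡⁅x⁆ : ∀ {n} (p : Subset n) → ∣ p ∣ ≡ 1 → ∃ λ x → p ≡ ⁅ x ⁆
∣p∣≡1⇒p≡⁅x⁆ (true  ∷ p) ∣p∣≡1 = zero , cong (true ∷_) (∣p∣≡0⇒p≡⊥ p (suc-injective ∣p∣≡1))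
∣p∣≡1⇒p≡⁅x⁆ (false ∷ p) ∣p∣≡1 with ∣p∣≡1⇒p≡⁅x⁆ p ∣p∣≡1
... | x , refl = suc x , refl

∣p∣≡2⇒p≡⁅x⁆∪⁅y⁆ : ∀ {n} (p : Subset n) → ∣ p ∣ ≡ 2 → ∃₂ λ x y → p ≡ ⁅ x ⁆ ∪ ⁅ y ⁆
∣p∣≡2⇒p≡⁅x⁆∪⁅y⁆ (true  ∷ p) ∣p∣≡2 with ∣p∣≡1⇒p≡⁅x⁆ p (suc-injective ∣p∣≡2)
... | y , refl = zero , suc y , cong (true ∷_) (sym (∪-identityˡ ⁅ y ⁆))
∣p∣≡2⇒p≡⁅x⁆∪⁅y⁆ (false ∷ p) ∣p∣≡2 with ∣p∣≡2⇒p≡⁅x⁆∪⁅y⁆ p ∣p∣≡2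
... | x , y , refl = suc x , suc y , refl

Π≤2⇒p≡⁅x⁆∪⁅y⁆ : ∀ {n} (p : Subset n) → InΠ≤2 p → ∃₂ λ x y → p ≡ ⁅ x ⁆ ∪ ⁅ y ⁆
Π≤2⇒p≡⁅x⁆∪⁅y⁆ p (inj₁ ∣p∣≡1) with ∣p∣≡1⇒p≡⁅x⁆ p ∣p∣≡1
... | x , refl = x , x , sym (∪-idem ⁅ x ⁆)
Π≤2⇒p≡⁅x⁆∪⁅y⁆ p (inj₂ ∣p∣≡2) = ∣p∣≡2⇒p≡⁅x⁆∪⁅y⁆ p ∣p∣≡2

infixl 6 _⊕ᵉ_
data Expr : Set where
  pair : ℕ → ℕ → Expr
  _⊕ᵉ_ : Expr → Expr → Expr

data Constraint : Set where
  ∣_∣≡_ : Expr → ℕ → Constraint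
  ∣_∣∉_ : Expr → List ℕ → Constraint
  _∉ᵉ_  : ℕ → Expr → Constraint

Labelling : Set
Labelling = ℕ → ℕ

-- pair i j stands for the set of the points i and j, which is the symmetric difference of their
-- singletons only when the points differ; so the labelling decides which variables to list.
vars : Labelling → Expr → List ℕ
vars f (pair i j) = if f i ≡ᵇ f j then i ∷ [] else i ∷ j ∷ []
vars f (e ⊕ᵉ e′)  = vars f e ++ vars f e′

labels : Labelling → Expr → List ℕ
labels f e = map f (vars f e)

oddIn : ℕ → List ℕ → Bool
oddIn x = foldr (λ y b → (x ≡ᵇ y) xor b) false

oddCount : List ℕ → ℕ
oddCount []       = 0
oddCount (x ∷ xs) = (if oddIn x xs then pred else suc) (oddCount xs)

size : Labelling → Expr → ℕ
size f e = oddCount (labels f e)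

notAmong : ℕ → List ℕ → Bool
notAmong k ks = not (does (Any.any? (k ℕ.≟_) ks))

holds : Labelling → Constraint → Bool
holds f (∣ e ∣≡ k)  = size f e ≡ᵇ k
holds f (∣ e ∣∉ ks) = notAmong (size f e) ks
holds f (i ∉ᵉ e)    = not (oddIn (f i) (labels f e))

module Semantics {n} (pt : ℕ → Fin n) where

  ⟦_⟧ : Expr → Subset n
  ⟦ pair i j ⟧ = ⁅ pt i ⁆ ∪ ⁅ pt j ⁆
  ⟦ e ⊕ᵉ e′ ⟧  = ⟦ e ⟧ ⊕ ⟦ e′ ⟧

  Sat : Constraint → Set
  Sat (∣ e ∣≡ k)  = ∣ ⟦ e ⟧ ∣ ≡ k
  Sat (∣ e ∣∉ ks) = All (∣ ⟦ e ⟧ ∣ ≢_) ks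
  Sat (i ∉ᵉ e)    = ¬ pt i ∈ ⟦ e ⟧

  ⨁ : List ℕ → Subset n
  ⨁ = foldr (λ i X → ⁅ pt i ⁆ ⊕ X) ⊥

  ⨁-++ : ∀ is js → ⨁ (is ++ js) ≡ ⨁ is ⊕ ⨁ js
  ⨁-++ []       js = sym (⊕-identityˡ (⨁ js))
  ⨁-++ (i ∷ is) js = trans (cong (⁅ pt i ⁆ ⊕_) (⨁-++ is js)) (sym (⊕-assoc ⁅ pt i ⁆ (⨁ is) (⨁ js)))

  module _ {g : Labelling} (same : ∀ i j → (g i ≡ᵇ g j) ≡ does (pt i ≟ pt j)) where

    ⟦⟧≡⨁vars : ∀ e → ⟦ e ⟧ ≡ ⨁ (vars g e)
    ⟦⟧≡⨁vars (pair i j) rewrite same i j with pt i ≟ pt j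
    ... | yes pti≡ptj rewrite pti≡ptj = trans (∪-idem ⁅ pt j ⁆) (sym (⊕-identityʳ ⁅ pt j ⁆))
    ... | no  pti≢ptj = trans (⁅x⁆∪⁅y⁆≡⁅x⁆⊕⁅y⁆ pti≢ptj) (cong (⁅ pt i ⁆ ⊕_) (sym (⊕-identityʳ ⁅ pt j ⁆)))
    ⟦⟧≡⨁vars (e ⊕ᵉ e′) = trans (cong₂ _⊕_ (⟦⟧≡⨁vars e) (⟦⟧≡⨁vars e′)) (sym (⨁-++ (vars g e) (vars g e′)))

    lookup-⨁ : ∀ is i → lookup (⨁ is) (pt i) ≡ oddIn (g i) (map g is)
    lookup-⨁ []       i = lookup-replicate (pt i) false
    lookup-⨁ (j ∷ js) i = trans (lookup-⊕ ⁅ pt j ⁆ (⨁ js) (pt i))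
      (cong₂ _xor_ (trans (lookup-⁅⁆ (pt j) (pt i)) (sym (same i j))) (lookup-⨁ js i))

    ∣⨁∣ : ∀ is → ∣ ⨁ is ∣ ≡ oddCount (map g is)
    ∣⨁∣ []       = ∣⊥∣≡0 n
    ∣⨁∣ (i ∷ is) = trans (∣⁅x⁆⊕p∣ (pt i) (⨁ is))
      (cong₂ (λ odd k → (if odd then pred else suc) k) (lookup-⨁ is i) (∣⨁∣ is))

    size≡∣⟦⟧∣ : ∀ e → size g e ≡ ∣ ⟦ e ⟧ ∣
    size≡∣⟦⟧∣ e = sym (trans (cong ∣_∣ (⟦⟧≡⨁vars e)) (∣⨁∣ (vars g e)))

    Sat⇒holds : ∀ c → Sat c → T (holds g c)
    Sat⇒holds (∣ e ∣≡ k)  ∣⟦e⟧∣≡k = ≡⇒≡ᵇ (size g e) k (trans (size≡∣⟦⟧∣ e) ∣⟦e⟧∣≡k)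
    Sat⇒holds (∣ e ∣∉ ks) ∣⟦e⟧∣≢ks = Equivalence.from T-not-≡ (dec-false (Any.any? (size g e ℕ.≟_) ks)
      (All¬⇒¬Any (subst (λ k → All (k ≢_) ks) (sym (size≡∣⟦⟧∣ e)) ∣⟦e⟧∣≢ks)))
    Sat⇒holds (i ∉ᵉ e)    i∉⟦e⟧ = Equivalence.from T-not-≡ (begin
      oddIn (g i) (labels g e)       ≡⟨ sym (lookup-⨁ (vars g e) i) ⟩
      lookup (⨁ (vars g e)) (pt i)  ≡⟨ cong (λ X → lookup X (pt i)) (sym (⟦⟧≡⨁vars e)) ⟩
      lookup ⟦ e ⟧ (pt i)           ≡⟨ ¬-not (i∉⟦e⟧ ∘ lookup⇒[]= (pt i) ⟦ e ⟧) ⟩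
      false                         ∎)
      where open ≡-Reasoning

least : (ℕ → Bool) → ℕ → ℕ
least p zero    = zero
least p (suc i) = if p (least p i) then least p i else suc i

least-≤ : ∀ p i → least p i ≤ i
least-≤ p zero = z≤n
least-≤ p (suc i) with p (least p i)
... | true  = m≤n⇒m≤1+n (least-≤ p i)
... | false = ≤-refl

least-sat : ∀ (p : ℕ → Bool) {i} → T (p i) → T (p (least p i))
least-sat p {zero}  pi = pi
least-sat p {suc i} pi with p (least p i) in p-least
... | true  = subst T (sym p-least) tt
... | false = pi

least-stable : ∀ (p : ℕ → Bool) {i j} → T (p i) → i ≤ j → least p j ≡ least p i
least-stable p {j = zero} pi z≤n = refl
least-stable p {i} {suc j} pi i≤1+j with m≤n⇒m<n∨m≡n i≤1+j
... | inj₂ refl = refl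
... | inj₁ (s≤s i≤j) = begin
  (if p (least p j) then least p j else suc j)
    ≡⟨ cong (λ l → if p l then l else suc j) (least-stable p pi i≤j) ⟩
  (if p (least p i) then least p i else suc j)
    ≡⟨ cong (if_then least p i else suc j) (Equivalence.to T-≡ (least-sat p pi)) ⟩
  least p i
    ∎
  where open ≡-Reasoning

least-unique : ∀ (p : ℕ → Bool) {i j} → T (p i) → T (p j) → least p i ≡ least p j
least-unique p {i} {j} pi pj with ≤-total i j
... | inj₁ i≤j = sym (least-stable p pi i≤j)
... | inj₂ j≤i = least-stable p pj j≤i

module FirstOccurrence {n} (pt : ℕ → Fin n) where

  first : Labelling
  first i = least (λ k → ⌊ pt k ≟ pt i ⌋) i

  first-≤ : ∀ i → first i ≤ i
  first-≤ i = least-≤ _ i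

  pt-first : ∀ i → pt (first i) ≡ pt i
  pt-first i = toWitness (least-sat (λ k → ⌊ pt k ≟ pt i ⌋) (fromWitness refl))

  first-cong : ∀ {i j} → pt i ≡ pt j → first i ≡ first j
  first-cong {i} {j} pti≡ptj =
    trans (least-unique (λ k → ⌊ pt k ≟ pt i ⌋) (fromWitness refl) (fromWitness (sym pti≡ptj)))
          (cong (λ x → least (λ k → ⌊ pt k ≟ x ⌋) j) pti≡ptj)

  first-idem : ∀ i → first (first i) ≡ first i
  first-idem i = first-cong (pt-first i)

  first-pattern : ∀ i j → (first i ≡ᵇ first j) ≡ does (pt i ≟ pt j)
  first-pattern i j = does-⇔ (mk⇔ same-point first-cong) (first i ℕ.≟ first j) (pt i ≟ pt j)
    where
    same-point : first i ≡ first j → pt i ≡ pt j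
    same-point fi≡fj = trans (sym (pt-first i)) (trans (cong pt fi≡fj) (pt-first j))

below : ℕ → Expr → Bool
below L (pair i j) = (i <ᵇ L) ∧ (j <ᵇ L)
below L (e ⊕ᵉ e′)  = below L e ∧ below L e′

inScope : ℕ → Constraint → Bool
inScope L (∣ e ∣≡ _) = below L e
inScope L (∣ e ∣∉ _) = below L e
inScope L (i ∉ᵉ e)   = (i <ᵇ L) ∧ below L e

Agree : ℕ → Labelling → Labelling → Set
Agree L f g = ∀ {i} → i < L → f i ≡ g i

vars-below : ∀ {L} h e → T (below L e) → All (_< L) (vars h e)
vars-below {L} h (pair i j) i,j<L with Equivalence.to T-∧ i,j<L | h i ≡ᵇ h j
... | i<L , j<L | true  = <ᵇ⇒< i L i<L ∷ []
... | i<L , j<L | false = <ᵇ⇒< i L i<L ∷ <ᵇ⇒< j L j<L ∷ []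
vars-below h (e ⊕ᵉ e′) e,e′<L with Equivalence.to T-∧ e,e′<L
... | e<L , e′<L = ++⁺ (vars-below h e e<L) (vars-below h e′ e′<L)

vars-agree : ∀ {L f g} e → Agree L f g → T (below L e) → vars f e ≡ vars g e
vars-agree {L} (pair i j) f≈g i,j<L with Equivalence.to T-∧ i,j<L
... | i<L , j<L rewrite f≈g (<ᵇ⇒< i L i<L) | f≈g (<ᵇ⇒< j L j<L) = refl
vars-agree (e ⊕ᵉ e′) f≈g e,e′<L with Equivalence.to T-∧ e,e′<L
... | e<L , e′<L rewrite vars-agree e f≈g e<L | vars-agree e′ f≈g e′<L = refl

labels-agree : ∀ {L f g} e → Agree L f g → T (below L e) → labels f e ≡ labels g e
labels-agree {g = g} e f≈g e<L rewrite vars-agree e f≈g e<L =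
  map-cong-local (All.map f≈g (vars-below g e e<L))

holds-agree : ∀ {L f g} c → Agree L f g → T (inScope L c) → holds f c ≡ holds g c
holds-agree (∣ e ∣≡ k)  f≈g e<L rewrite labels-agree e f≈g e<L = refl
holds-agree (∣ e ∣∉ ks) f≈g e<L rewrite labels-agree e f≈g e<L = refl
holds-agree {L} (i ∉ᵉ e) f≈g i,e<L with Equivalence.to T-∧ i,e<L
... | i<L , e<L rewrite labels-agree e f≈g e<L | f≈g (<ᵇ⇒< i L i<L) = refl

_[_≔_] : Labelling → ℕ → ℕ → Labelling
(f [ L ≔ v ]) i = if i ≡ᵇ L then v else f i

isClass : Labelling → ℕ → ℕ → Bool
isClass f L v = (v ≡ᵇ L) ∨ (f v ≡ᵇ v)

isNew : ℕ → Constraint → Bool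
isNew L c = inScope L c ∧ not (inScope (pred L) c)

violates : Labelling → ℕ → Constraint → Bool
violates f L c = isNew L c ∧ not (holds f c)

violated : List Constraint → Labelling → ℕ → Bool
violated cs f L = any (violates f L) cs

-- refuted cs k f L: however the variables L, …, L + k - 1 are labelled after the labels f gives
-- to 0, …, L - 1, each by a fresh label or by the label of an earlier class representative, some
-- constraint of cs fails at the moment its last variable is labelled.
refuted : List Constraint → ℕ → Labelling → ℕ → Bool
refuted cs zero    f L = violated cs f L
refuted cs (suc k) f L = violated cs f L ∨
  all (λ v → not (isClass f L v) ∨ refuted cs k (f [ L ≔ v ]) (suc L)) (upTo (suc L))

module Refutation {cs : List Constraint} {g : Labelling}
                  (g≤ : ∀ i → g i ≤ i) (g-idem : ∀ i → g (g i) ≡ g i)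
                  (sat : All (T ∘ holds g) cs) where

  violation-impossible : ∀ {f L} c → Agree L f g → T (holds g c) → ¬ T (violates f L c)
  violation-impossible c f≈g holds-g new∧fails =
    let new , fails = Equivalence.to T-∧ new∧fails
        holds-f     = subst T (sym (holds-agree c f≈g (proj₁ (Equivalence.to T-∧ new)))) holds-g
    in subst T (Equivalence.to T-not-≡ fails) holds-f

  not-violated : ∀ {f L} → Agree L f g → ¬ T (violated cs f L)
  not-violated {f} {L} f≈g v =
    All.lookupWith (λ {c} → violation-impossible c f≈g) sat (any⁻ (violates f L) cs v)

  extend-agrees : ∀ {f L} → Agree L f g → Agree (suc L) (f [ L ≔ g L ]) g
  extend-agrees {f} {L} f≈g {i} i<1+L with i ≡ᵇ L in i≟L
  ... | true  = cong g (sym (≡ᵇ⇒≡ i L (subst T (sym i≟L) tt)))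
  ... | false = f≈g (≤∧≢⇒< (s≤s⁻¹ i<1+L) (λ i≡L → subst T i≟L (≡⇒≡ᵇ i L i≡L)))

  isClass-g : ∀ {f L} → Agree L f g → T (isClass f L (g L))
  isClass-g {f} {L} f≈g with m≤n⇒m<n∨m≡n (g≤ L)
  ... | inj₂ gL≡L = Equivalence.from T-∨ (inj₁ (≡⇒≡ᵇ (g L) L gL≡L))
  ... | inj₁ gL<L = Equivalence.from T-∨ (inj₂ (≡⇒≡ᵇ (f (g L)) (g L) (trans (f≈g gL<L) (g-idem L))))

  not-refuted : ∀ k {f L} → Agree L f g → ¬ T (refuted cs k f L)
  not-refuted zero    f≈g r = not-violated f≈g r
  not-refuted (suc k) {f} {L} f≈g r with Equivalence.to T-∨ r
  ... | inj₁ v = not-violated f≈g v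
  ... | inj₂ a with Equivalence.to T-∨ (All.lookup (all⁺ _ _ a) (∈-upTo⁺ (s≤s (g≤ L))))
  ...   | inj₁ notClass = subst T (Equivalence.to T-not-≡ notClass) (isClass-g f≈g)
  ...   | inj₂ r′       = not-refuted k (extend-agrees f≈g) r′

-- Certificates are stated as refuted … ≡ true rather than as T (refuted …): Agda checks refl
-- against the former much faster.
refute : ∀ {n} (pt : ℕ → Fin n) cs k → refuted cs k id 0 ≡ true → ¬ All (Semantics.Sat pt) cs
refute pt cs k r sats = not-refuted k (λ ()) (subst T (sym r) tt)
  where
  open FirstOccurrence pt
  open Refutation first-≤ first-idem (All.map (Semantics.Sat⇒holds pt first-pattern _) sats)

Admissible : ℕ → Set
Admissible c = c ≡ 0 ⊎ c ≡ 3 ⊎ c ≡ 4 ⊎ c ≡ 5 ⊎ c ≡ 6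

admissible? : ∀ c → Dec (Admissible c)
admissible? c = (c ℕ.≟ 0) ⊎-dec (c ℕ.≟ 3) ⊎-dec (c ℕ.≟ 4) ⊎-dec (c ℕ.≟ 5) ⊎-dec (c ℕ.≟ 6)

admissibleSizes : List ℕ
admissibleSizes = 0 ∷ 3 ∷ 4 ∷ 5 ∷ 6 ∷ []

¬Admissible⇒≢ : ∀ {c} → ¬ Admissible c → All (c ≢_) admissibleSizes
¬Admissible⇒≢ ¬adm = ¬adm ∘ inj₁ ∷ ¬adm ∘ inj₂ ∘ inj₁ ∷ ¬adm ∘ inj₂ ∘ inj₂ ∘ inj₁
                   ∷ ¬adm ∘ inj₂ ∘ inj₂ ∘ inj₂ ∘ inj₁ ∷ ¬adm ∘ inj₂ ∘ inj₂ ∘ inj₂ ∘ inj₂ ∷ []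

Inadmissible : ∀ {n} → Subset n → Subset n → Subset n → Set
Inadmissible C X Y = ¬ Admissible ∣ X ⊕ Y ⊕ C ∣

Inadmissible-⊥ : ∀ {n} (X Y : Subset n) → Inadmissible ⊥ X Y → ¬ Admissible ∣ X ⊕ Y ∣
Inadmissible-⊥ X Y inadm = inadm ∘ subst Admissible (cong ∣_∣ (sym (⊕-identityʳ (X ⊕ Y))))

pairwise : (Expr → Expr → Constraint) → List Expr → List Constraint
pairwise κ []       = []
pairwise κ (e ∷ es) = map (κ e) es ++ pairwise κ es

module _ {n} {pt : ℕ → Fin n} where
  open Semantics pt

  AllPairs⇒Sat : ∀ {P : Subset n → Subset n → Set} {κ} → (∀ {x y} → P ⟦ x ⟧ ⟦ y ⟧ → Sat (κ x y)) →
                 ∀ {es} → AllPairs P (map ⟦_⟧ es) → All Sat (pairwise κ es)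
  AllPairs⇒Sat P⇒Sat {[]}     []         = []
  AllPairs⇒Sat P⇒Sat {e ∷ es} (Pe ∷ Pes) = ++⁺ (map⁺ (All.map P⇒Sat (map⁻ Pe))) (AllPairs⇒Sat P⇒Sat Pes)

nth : ∀ {A : Set} → A → List A → ℕ → A
nth d xs i = fromMaybe d (head (drop i xs))

set : ℕ → Expr
set t = pair (2 * t) (1 + 2 * t)

inadmissibleᵉ : Expr → Expr → Expr → Constraint
inadmissibleᵉ c x y = ∣ x ⊕ᵉ y ⊕ᵉ c ∣∉ admissibleSizes

inadmissibleᵉ⊥ : Expr → Expr → Constraint
inadmissibleᵉ⊥ x y = ∣ x ⊕ᵉ y ∣∉ admissibleSizes

large-C-constraints : List Constraint
large-C-constraints =
  ∣ set 0 ∣≡ 2 ∷ ∣ set 0 ⊕ᵉ set 1 ⊕ᵉ set 2 ∣∉ (0 ∷ 1 ∷ 2 ∷ []) ∷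
  pairwise (inadmissibleᵉ (set 0 ⊕ᵉ set 1 ⊕ᵉ set 2)) (set 5 ∷ set 4 ∷ set 3 ∷ set 0 ∷ set 1 ∷ [])

large-C-refutable : refuted large-C-constraints 12 id 0 ≡ true
large-C-refutable = refl

quadruple-constraints : List Constraint
quadruple-constraints =
  ∣ set 0 ∣≡ 2 ∷ 0 ∉ᵉ set 1 ∷ 1 ∉ᵉ set 2 ∷ pairwise inadmissibleᵉ⊥ (set 3 ∷ set 2 ∷ set 1 ∷ set 0 ∷ [])

quadruple-refutable : refuted quadruple-constraints 8 id 0 ≡ true
quadruple-refutable = refl

disjoint-pair-constraints : List Constraint
disjoint-pair-constraints = ∣ set 0 ∣≡ 2 ∷ 0 ∉ᵉ set 1 ∷ 1 ∉ᵉ set 1 ∷ inadmissibleᵉ⊥ (set 0) (set 1) ∷ []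

disjoint-pair-refutable : refuted disjoint-pair-constraints 4 id 0 ≡ true
disjoint-pair-refutable = refl

large-C-impossible : ∀ {n} (R S T P Q U : Subset n) →
  InΠ≤2 R → InΠ≤2 S → InΠ≤2 T → InΠ≤2 P → InΠ≤2 Q → InΠ≤2 U → ∣ R ∣ ≡ 2 →
  ∣ R ⊕ S ⊕ T ∣ ≢ 0 → ∣ R ⊕ S ⊕ T ∣ ≢ 1 → ∣ R ⊕ S ⊕ T ∣ ≢ 2 →
  ¬ AllPairs (Inadmissible (R ⊕ S ⊕ T)) (U ∷ Q ∷ P ∷ R ∷ S ∷ [])
large-C-impossible R S T P Q U RΠ SΠ TΠ PΠ QΠ UΠ ∣R∣≡2 C≢0 C≢1 C≢2 inadm
  with Π≤2⇒p≡⁅x⁆∪⁅y⁆ R RΠ | Π≤2⇒p≡⁅x⁆∪⁅y⁆ S SΠ | Π≤2⇒p≡⁅x⁆∪⁅y⁆ T TΠ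
     | Π≤2⇒p≡⁅x⁆∪⁅y⁆ P PΠ | Π≤2⇒p≡⁅x⁆∪⁅y⁆ Q QΠ | Π≤2⇒p≡⁅x⁆∪⁅y⁆ U UΠ
... | r₀ , r₁ , refl | s₀ , s₁ , refl | t₀ , t₁ , refl | p₀ , p₁ , refl | q₀ , q₁ , refl | u₀ , u₁ , refl =
  refute pt large-C-constraints 12 large-C-refutable
    (∣R∣≡2 ∷ (C≢0 ∷ C≢1 ∷ C≢2 ∷ []) ∷
     AllPairs⇒Sat {κ = inadmissibleᵉ (set 0 ⊕ᵉ set 1 ⊕ᵉ set 2)} ¬Admissible⇒≢
                  {es = set 5 ∷ set 4 ∷ set 3 ∷ set 0 ∷ set 1 ∷ []} inadm)
  where
  pt : ℕ → Fin _
  pt = nth r₀ (r₀ ∷ r₁ ∷ s₀ ∷ s₁ ∷ t₀ ∷ t₁ ∷ p₀ ∷ p₁ ∷ q₀ ∷ q₁ ∷ u₀ ∷ u₁ ∷ [])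

quadruple-impossible : ∀ {n} (a b : Fin n) (Y Z W : Subset n) → InΠ≤2 Y → InΠ≤2 Z → InΠ≤2 W →
  ∣ ⁅ a ⁆ ∪ ⁅ b ⁆ ∣ ≡ 2 → ¬ a ∈ Y → ¬ b ∈ Z →
  ¬ AllPairs (Inadmissible ⊥) (W ∷ Z ∷ Y ∷ ⁅ a ⁆ ∪ ⁅ b ⁆ ∷ [])
quadruple-impossible a b Y Z W YΠ ZΠ WΠ ∣ab∣≡2 a∉Y b∉Z inadm
  with Π≤2⇒p≡⁅x⁆∪⁅y⁆ Y YΠ | Π≤2⇒p≡⁅x⁆∪⁅y⁆ Z ZΠ | Π≤2⇒p≡⁅x⁆∪⁅y⁆ W WΠ
... | y₀ , y₁ , refl | z₀ , z₁ , refl | w₀ , w₁ , refl =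
  refute pt quadruple-constraints 8 quadruple-refutable
    (∣ab∣≡2 ∷ a∉Y ∷ b∉Z ∷
     AllPairs⇒Sat {κ = inadmissibleᵉ⊥} (λ {x} {y} → ¬Admissible⇒≢ ∘ Inadmissible-⊥ ⟦ x ⟧ ⟦ y ⟧)
                  {es = set 3 ∷ set 2 ∷ set 1 ∷ set 0 ∷ []} inadm)
  where
  pt : ℕ → Fin _
  pt = nth a (a ∷ b ∷ y₀ ∷ y₁ ∷ z₀ ∷ z₁ ∷ w₀ ∷ w₁ ∷ [])
  open Semantics pt using (⟦_⟧)

disjoint-pair-impossible : ∀ {n} (a b : Fin n) (Y : Subset n) → InΠ≤2 Y →
  ∣ ⁅ a ⁆ ∪ ⁅ b ⁆ ∣ ≡ 2 → ¬ a ∈ Y → ¬ b ∈ Y → ¬ Inadmissible ⊥ (⁅ a ⁆ ∪ ⁅ b ⁆) Y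
disjoint-pair-impossible a b Y YΠ ∣ab∣≡2 a∉Y b∉Y inadm with Π≤2⇒p≡⁅x⁆∪⁅y⁆ Y YΠ
... | y₀ , y₁ , refl =
  refute pt disjoint-pair-constraints 4 disjoint-pair-refutable
    (∣ab∣≡2 ∷ a∉Y ∷ b∉Y ∷ ¬Admissible⇒≢ (Inadmissible-⊥ (⁅ a ⁆ ∪ ⁅ b ⁆) _ inadm) ∷ [])
  where
  pt : ℕ → Fin _
  pt = nth a (a ∷ b ∷ y₀ ∷ y₁ ∷ [])

length-covering : ∀ {m} {xs : List (Fin m)} → (∀ k → Any.Any (k ≡_) xs) → m ≤ length xs
length-covering {xs = xs} covered = ≮⇒≥ λ |xs|<m →
  let i , j , i<j , same-index = pigeonhole |xs|<m (Any.index ∘ covered)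
  in <⇒≢ᶠ i<j (trans (lookup-index (covered i))
                     (trans (cong (List.lookup xs) same-index) (sym (lookup-index (covered j)))))

fresh : ∀ {m} (xs : List (Fin m)) → length xs < m → ∃ λ k → All (k ≢_) xs
fresh xs |xs|<m with any? (λ k → All.all? (λ x → ¬? (k ≟ x)) xs)
... | yes k∉xs = k∉xs
... | no  none = contradiction (length-covering covered) (<⇒≱ |xs|<m)
  where
  covered : ∀ k → Any.Any (k ≡_) xs
  covered k with Any.any? (k ≟_) xs
  ... | yes k∈xs = k∈xs
  ... | no  k∉xs = contradiction (k , ¬Any⇒All¬ xs k∉xs) none

extend-Unique : ∀ {m} k (xs : List (Fin m)) → Unique xs → k + length xs ≤ m →
                ∃ λ ys → length ys ≡ k × Unique (ys ++ xs)
extend-Unique zero    xs xs! _ = [] , refl , xs!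
extend-Unique (suc k) xs xs! 1+k+|xs|≤m with extend-Unique k xs xs! (≤-trans (n≤1+n _) 1+k+|xs|≤m)
... | ys , refl , ys++xs! with fresh (ys ++ xs) (subst (_< _) (sym (length-++ ys)) 1+k+|xs|≤m)
...   | y , y∉ys++xs = y ∷ ys , refl , y∉ys++xs ∷ ys++xs!

module _ {n m} (S : Fin m → Subset n) (SΠ : ∀ i → InΠ≤2 (S i))
         (inadm : ∀ p q → p ≢ q → Inadmissible ⊥ (S p) (S q))
         {r a b} (Sr≡ab : S r ≡ ⁅ a ⁆ ∪ ⁅ b ⁆) (∣Sr∣≡2 : ∣ S r ∣ ≡ 2) where

  private
    ∣ab∣≡2 : ∣ ⁅ a ⁆ ∪ ⁅ b ⁆ ∣ ≡ 2
    ∣ab∣≡2 = subst (λ X → ∣ X ∣ ≡ 2) Sr≡ab ∣Sr∣≡2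

    a∈Sr : a ∈ S r
    a∈Sr = subst (a ∈_) (sym Sr≡ab) (x∈p∪q⁺ (inj₁ (x∈⁅x⁆ a)))

    b∈Sr : b ∈ S r
    b∈Sr = subst (b ∈_) (sym Sr≡ab) (x∈p∪q⁺ (inj₂ (x∈⁅x⁆ b)))

    ∉⇒≢r : ∀ {x i} → x ∈ S r → ¬ x ∈ S i → i ≢ r
    ∉⇒≢r x∈Sr x∉Si refl = x∉Si x∈Sr

  missing-a⇒b∈ : 3 < m → ∀ {i} j → ¬ a ∈ S i → b ∈ S j
  missing-a⇒b∈ 3<m {i} j a∉Si with b ∈? S j
  ... | yes b∈Sj = b∈Sj
  ... | no  b∉Sj with i ≟ j
  ...   | yes refl = ⊥-elim (disjoint-pair-impossible a b (S i) (SΠ i) ∣ab∣≡2 a∉Si b∉Sj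
                       (subst (λ X → Inadmissible ⊥ X (S i)) Sr≡ab (inadm r i (≢-sym (∉⇒≢r a∈Sr a∉Si)))))
  ...   | no  i≢j with extend-Unique 1 (j ∷ i ∷ r ∷ [])
                         ((≢-sym i≢j ∷ ∉⇒≢r b∈Sr b∉Sj ∷ []) ∷ (∉⇒≢r a∈Sr a∉Si ∷ []) ∷ [] ∷ []) 3<m
  ...     | k ∷ [] , refl , distinct =
    ⊥-elim (quadruple-impossible a b (S i) (S j) (S k) (SΠ i) (SΠ j) (SΠ k) ∣ab∣≡2 a∉Si b∉Sj
             (subst (λ X → AllPairs (Inadmissible ⊥) (S k ∷ S j ∷ S i ∷ X ∷ [])) Sr≡ab
                    (AllPairs-map⁺ (AllPairs.map (inadm _ _) distinct))))

common-point : ∀ {n m} (S : Fin m → Subset n) → 3 < m → (∀ i → InΠ≤2 (S i)) →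
               (∀ p q → p ≢ q → Inadmissible ⊥ (S p) (S q)) →
               ∀ r → ∣ S r ∣ ≡ 2 → ∃[ x ] (∀ i → x ∈ S i)
common-point {m = m} S 3<m SΠ inadm r ∣Sr∣≡2 with Π≤2⇒p≡⁅x⁆∪⁅y⁆ (S r) (SΠ r)
... | a , b , Sr≡ab with all? (λ i → a ∈? S i)
...   | yes a∈S = a , a∈S
...   | no  a∉S with ¬∀⟶∃¬ m _ (λ i → a ∈? S i) a∉S
...     | i , a∉Si = b , λ j → missing-a⇒b∈ S SΠ inadm Sr≡ab ∣Sr∣≡2 3<m j a∉Si

large-C-family-impossible : ∀ {n m} (S : Fin m → Subset n) (T : Subset n) → 4 < m →
  (∀ i → InΠ≤2 (S i)) → InΠ≤2 T → ∀ {r s} → r ≢ s → ∣ S r ∣ ≡ 2 →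
  ∣ S r ⊕ S s ⊕ T ∣ ≢ 0 → ∣ S r ⊕ S s ⊕ T ∣ ≢ 1 → ∣ S r ⊕ S s ⊕ T ∣ ≢ 2 →
  ¬ (∀ p q → p ≢ q → Inadmissible (S r ⊕ S s ⊕ T) (S p) (S q))
large-C-family-impossible S T 4<m SΠ TΠ {r} {s} r≢s ∣Sr∣≡2 C≢0 C≢1 C≢2 inadm
  with extend-Unique 3 (r ∷ s ∷ []) ((r≢s ∷ []) ∷ [] ∷ []) 4<m
... | k₂ ∷ k₁ ∷ k₀ ∷ [] , refl , distinct =
  large-C-impossible (S r) (S s) T (S k₀) (S k₁) (S k₂) (SΠ r) (SΠ s) TΠ (SΠ k₀) (SΠ k₁) (SΠ k₂)
    ∣Sr∣≡2 C≢0 C≢1 C≢2 (AllPairs-map⁺ (AllPairs.map (inadm _ _) distinct))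

no-witness⇒common-point : ∀ {n m} (S : Fin m → Subset n) (T : Subset n) → 4 < m →
  (∀ i → InΠ≤2 (S i)) → InΠ≤2 T → ∀ {r s} → r ≢ s → ∣ S r ∣ ≡ 2 →
  ∣ S r ⊕ S s ⊕ T ∣ ≢ 1 → ∣ S r ⊕ S s ⊕ T ∣ ≢ 2 →
  (∀ p q → p ≢ q → Inadmissible (S r ⊕ S s ⊕ T) (S p) (S q)) → ∃[ b ] (∀ i → b ∈ S i)
no-witness⇒common-point S T 4<m SΠ TΠ {r} {s} r≢s ∣Sr∣≡2 C≢1 C≢2 inadm with ∣ S r ⊕ S s ⊕ T ∣ ℕ.≟ 0
... | no  C≢0 = ⊥-elim (large-C-family-impossible S T 4<m SΠ TΠ r≢s ∣Sr∣≡2 C≢0 C≢1 C≢2 inadm)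
... | yes C≡0 = common-point S (<⇒≤ 4<m) SΠ
                  (subst (λ C → ∀ p q → p ≢ q → Inadmissible C (S p) (S q)) (∣p∣≡0⇒p≡⊥ _ C≡0) inadm)
                  r ∣Sr∣≡2

lemma3p8 : (n m : ℕ) → .{{NonZero n}} → .{{NonZero m}}
    → (S : Fin m → Subset n) → (∀ i → InΠ≤2 (S i))
    → (∀ i j → i ≢ j → S i ≢ S j)
    → (T : Subset n) → InΠ≤2 T
    → (r s : Fin m) → r ≢ s → ∣ S r ∣ ≡ 2 → S r ≢ T → T ≢ S s
    → ¬ (∣ S r ⊕ S s ⊕ T ∣ ≡ 1) → ¬ (∣ S r ⊕ S s ⊕ T ∣ ≡ 2)
    → (∃[ p ] ∃[ q ] (p ≢ q × (∣ S p ⊕ S q ⊕ (S r ⊕ S s ⊕ T) ∣ ≡ 0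
                              ⊎ ∣ S p ⊕ S q ⊕ (S r ⊕ S s ⊕ T) ∣ ≡ 3
                              ⊎ ∣ S p ⊕ S q ⊕ (S r ⊕ S s ⊕ T) ∣ ≡ 4
                              ⊎ ∣ S p ⊕ S q ⊕ (S r ⊕ S s ⊕ T) ∣ ≡ 5
                              ⊎ ∣ S p ⊕ S q ⊕ (S r ⊕ S s ⊕ T) ∣ ≡ 6)))
      ⊎ (∃[ b ] (∀ i → b ∈ S i))
      ⊎ m ≤ 5
lemma3p8 n m S SΠ _ T TΠ r s r≢s ∣Sr∣≡2 _ _ C≢1 C≢2
  with any? (λ p → any? (λ q → ¬? (p ≟ q) ×-dec admissible? ∣ S p ⊕ S q ⊕ (S r ⊕ S s ⊕ T) ∣))
... | yes witness = inj₁ witness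
... | no  none with m ≤? 5
...   | yes m≤5 = inj₂ (inj₂ m≤5)
...   | no  m≰5 = inj₂ (inj₁ (no-witness⇒common-point S T (<⇒≤ (≰⇒> m≰5)) SΠ TΠ r≢s ∣Sr∣≡2 C≢1 C≢2
                                (λ p q p≢q admissible → none (p , q , p≢q , admissible))))
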